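{- Let $\mathbf P=(P,\leq)$ be a poset and $T$ a tolerance on $\mathbf P$. Then $(P/T,\sqsubseteq)$ is a poset, i.e. $\sqsubseteq$ is a partial order relation on the set $P/T$ of blocks of $T$.
   Context: For a poset $\mathbf P=(P,\leq)$ and $x,y\in P$, $x\vee y$ and $x\wedge y$ denote the supremum and infimum of $\{x,y\}$ in $\mathbf P$ (when they exist). A tolerance on $\mathbf P$ is a reflexive and symmetric binary relation $T$ on $P$ satisfying: (1) if $(x,y),(z,u)\in T$ and $x\vee z$ and $y\vee u$ exist then $(x\vee z,y\vee u)\in T$; (2) if $(x,y),(z,u)\in T$ and $x\wedge z$ and $y\wedge u$ exist then $(x\wedge z,y\wedge u)\in T$; (3) if $x,y,z\in P$, $(x,y),(y,z)\in T$ and $T\neq P^2$, then there exist $u,v\in P$ with $u\leq x,y,z\leq v$ and $(u,y),(y,v)\in T$; (4) if $(x,y)\in T$ and $T\neq P^2$, then there exists some $(z,u)\in T$ with $z\leq x,y\leq u$ and such that $(v,z),(v,u)\in T$ for all $v\in P$ with $(v,x),(v,y)\in T$. A block of $T$ is a maximal subset $B\subseteq P$ with $B^2\subseteq T$; $P/T$ is the set of blocks. For $B_1,B_2\in P/T$ define $B_1\sqsubseteq B_2$ iff for every $b_1\in B_1$ there exists $b_2'\in B_2$ with $b_1\leq b_2'$, and for every $b_2\in B_2$ there exists $b_1'\in B_1$ with $b_1'\leq b_2$. -}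

module Defs where

open import Level using (Level; _⊔_; suc)
open import Data.Product using (Σ; ∃; _×_; _,_)
open import Relation.Nullary using (¬_)
open import Relation.Binary.Core using (Rel)
open import Relation.Binary.PropositionalEquality using (_≡_)
open import Relation.Unary using (Pred; _⊆_; _∈_)

module _ {a ℓ t : Level} {P : Set a} (_≤_ : Rel P ℓ) where

  IsSup : P → P → P → Set (a ⊔ ℓ)
  IsSup x y s = (x ≤ s) × (y ≤ s) × (∀ w → x ≤ w → y ≤ w → s ≤ w)

  IsInf : P → P → P → Set (a ⊔ ℓ)
  IsInf x y i = (i ≤ x) × (i ≤ y) × (∀ w → w ≤ x → w ≤ y → w ≤ i)

  IsFull : Rel P t → Set (a ⊔ t)
  IsFull T = ∀ x y → T x y

  record IsTolerance (T : Rel P t) : Set (a ⊔ ℓ ⊔ t) where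
    field
      refl  : ∀ x → T x x
      sym   : ∀ {x y} → T x y → T y x
      join  : ∀ {x y z u s₁ s₂} → T x y → T z u →
              IsSup x z s₁ → IsSup y u s₂ → T s₁ s₂
      meet  : ∀ {x y z u i₁ i₂} → T x y → T z u →
              IsInf x z i₁ → IsInf y u i₂ → T i₁ i₂
      cond3 : ∀ {x y z} → T x y → T y z → ¬ IsFull T →
              Σ P λ u → Σ P λ v →
                (u ≤ x) × (u ≤ y) × (u ≤ z) ×
                (x ≤ v) × (y ≤ v) × (z ≤ v) ×
                T u y × T y v
      cond4 : ∀ {x y} → T x y → ¬ IsFull T →
              Σ P λ z → Σ P λ u →
                T z u × (z ≤ x) × (z ≤ y) × (x ≤ u) × (y ≤ u) ×
                (∀ v → T v x → T v y → T v z × T v u)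

  Subset : Set (suc (a ⊔ t))
  Subset = Pred P (a ⊔ t)

  Square⊆ : Rel P t → Subset → Set (a ⊔ t)
  Square⊆ T B = ∀ {x y} → x ∈ B → y ∈ B → T x y

  IsBlock : Rel P t → Subset → Set (suc (a ⊔ t))
  IsBlock T B = Square⊆ T B × (∀ (C : Subset) → Square⊆ T C → B ⊆ C → C ⊆ B)

  Block : Rel P t → Set (suc (a ⊔ t))
  Block T = Σ Subset (IsBlock T)

  _≐ᴮ_ : {T : Rel P t} → Block T → Block T → Set (a ⊔ t)
  (B , _) ≐ᴮ (C , _) = (B ⊆ C) × (C ⊆ B)

  _⊑_ : {T : Rel P t} → Block T → Block T → Set (a ⊔ ℓ ⊔ t)
  (B₁ , _) ⊑ (B₂ , _) =
    (∀ {b₁} → b₁ ∈ B₁ → ∃ λ b₂ → b₂ ∈ B₂ × (b₁ ≤ b₂)) ×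
    (∀ {b₂} → b₂ ∈ B₂ → ∃ λ b₁ → b₁ ∈ B₁ × (b₁ ≤ b₂))

-- If B ⊑ C and C ⊑ B, then every x ∈ B and y ∈ C are T-related: pick b ∈ B below y
-- and c ∈ C below x; the tolerance pairs (x , b) and (c , y) join to (x ∨ c , b ∨ y) = (x , y).
-- Hence B ∪ C is a T-square, and maximality of the blocks B and C forces B = C.
module Submission where

open import Defs
open import Level using (Level; _⊔_) renaming (suc to lsuc)
open import Data.Product using (∃; _×_; _,_)
open import Data.Sum using (inj₁; inj₂)
open import Relation.Binary.Core using (Rel)
open import Relation.Binary.Definitions using (Reflexive; Transitive)
open import Relation.Binary.Structures using (IsPartialOrder; IsEquivalence)
open import Relation.Binary.PropositionalEquality using (_≡_)
open import Relation.Unary using (_⊆_; _∈_; _∪_)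

module Blocks {a ℓ t : Level} {P : Set a} (_≤_ : Rel P ℓ) (T : Rel P t) where

  Subsetᴾ : Set (lsuc (a ⊔ t))
  Subsetᴾ = Subset {t = t} _≤_

  ≤⇒isSupˡ : Reflexive _≤_ → ∀ {x y} → y ≤ x → IsSup {t = t} _≤_ x y x
  ≤⇒isSupˡ ≤-refl y≤x = ≤-refl , y≤x , λ _ x≤w _ → x≤w

  ≤⇒isSupʳ : Reflexive _≤_ → ∀ {x y} → x ≤ y → IsSup {t = t} _≤_ x y y
  ≤⇒isSupʳ ≤-refl x≤y = x≤y , ≤-refl , λ _ _ y≤w → y≤w

  LowerCovered : Subsetᴾ → Subsetᴾ → Set (a ⊔ ℓ ⊔ t)
  LowerCovered B C = ∀ {c} → c ∈ C → ∃ λ b → b ∈ B × (b ≤ c)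

  block-∪-square⇒⊆ : ∀ {B : Subsetᴾ} (C : Subsetᴾ) →
    IsBlock _≤_ T B → Square⊆ _≤_ T (B ∪ C) → C ⊆ B
  block-∪-square⇒⊆ C (_ , maximal) sq∪ c∈C = maximal (_ ∪ C) sq∪ inj₁ (inj₂ c∈C)

  ≐ᴮ-isEquivalence : IsEquivalence (_≐ᴮ_ _≤_ {T})
  ≐ᴮ-isEquivalence = record
    { refl  = (λ x∈B → x∈B) , (λ x∈B → x∈B)
    ; sym   = λ (B⊆C , C⊆B) → C⊆B , B⊆C
    ; trans = λ (B⊆C , C⊆B) (C⊆D , D⊆C) → (λ x∈B → C⊆D (B⊆C x∈B)) , (λ x∈D → C⊆B (D⊆C x∈D))
    }

  ⊑-trans : Transitive _≤_ → Transitive (_⊑_ _≤_ {T})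
  ⊑-trans ≤-trans (up₁ , down₁) (up₂ , down₂) =
    (λ b∈B → let (c , c∈C , b≤c) = up₁ b∈B ; (d , d∈D , c≤d) = up₂ c∈C
             in d , d∈D , ≤-trans b≤c c≤d)
    , (λ d∈D → let (c , c∈C , c≤d) = down₂ d∈D ; (b , b∈B , b≤c) = down₁ c∈C
               in b , b∈B , ≤-trans b≤c c≤d)

  module _ (≤-refl : Reflexive _≤_) where

    ⊑-reflexive : ∀ {B C : Block _≤_ T} → _≐ᴮ_ _≤_ B C → _⊑_ _≤_ B C
    ⊑-reflexive (B⊆C , C⊆B) =
      (λ {b} b∈B → b , B⊆C b∈B , ≤-refl) , (λ {c} c∈C → c , C⊆B c∈C , ≤-refl)

    module _ (tol : IsTolerance {t = t} _≤_ T) where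
      open IsTolerance tol using (join) renaming (sym to T-sym)

      mutuallyLowerCovered⇒related : ∀ {B C : Subsetᴾ} →
        Square⊆ _≤_ T B → Square⊆ _≤_ T C → LowerCovered B C → LowerCovered C B →
        ∀ {x y} → x ∈ B → y ∈ C → T x y
      mutuallyLowerCovered⇒related sqB sqC B≼C C≼B x∈B y∈C
        with B≼C y∈C | C≼B x∈B
      ... | b , b∈B , b≤y | c , c∈C , c≤x =
        join (sqB x∈B b∈B) (sqC c∈C y∈C) (≤⇒isSupˡ ≤-refl c≤x) (≤⇒isSupʳ ≤-refl b≤y)

      mutuallyLowerCovered⇒∪-square : ∀ {B C : Subsetᴾ} →
        Square⊆ _≤_ T B → Square⊆ _≤_ T C → LowerCovered B C → LowerCovered C B →
        Square⊆ _≤_ T (B ∪ C)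
      mutuallyLowerCovered⇒∪-square {B} {C} sqB sqC B≼C C≼B = square
        where
        related : ∀ {x y} → x ∈ B → y ∈ C → T x y
        related = mutuallyLowerCovered⇒related sqB sqC B≼C C≼B
        square : Square⊆ _≤_ T (B ∪ C)
        square (inj₁ x∈B) (inj₁ y∈B) = sqB x∈B y∈B
        square (inj₂ x∈C) (inj₂ y∈C) = sqC x∈C y∈C
        square (inj₁ x∈B) (inj₂ y∈C) = related x∈B y∈C
        square (inj₂ x∈C) (inj₁ y∈B) = T-sym (related y∈B x∈C)

      ⊑-antisym : ∀ {B C : Block _≤_ T} → _⊑_ _≤_ B C → _⊑_ _≤_ C B → _≐ᴮ_ _≤_ B C
      ⊑-antisym {B , isBlockB@(sqB , _)} {C , isBlockC@(sqC , _)} (_ , B≼C) (_ , C≼B) =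
        block-∪-square⇒⊆ B isBlockC (mutuallyLowerCovered⇒∪-square sqC sqB C≼B B≼C)
        , block-∪-square⇒⊆ C isBlockB (mutuallyLowerCovered⇒∪-square sqB sqC B≼C C≼B)

theorem4 : {a ℓ t : Level} {P : Set a} (_≤_ : Rel P ℓ) →
           IsPartialOrder _≡_ _≤_ →
           (T : Rel P t) → IsTolerance {t = t} _≤_ T →
           IsPartialOrder (_≐ᴮ_ _≤_ {T}) (_⊑_ _≤_ {T})
-- _≐ᴮ_ and _⊑_ match on the block pairs, so they are not injective and the
-- implicit blocks have to be passed on by hand.
theorem4 _≤_ po T tol = record
  { isPreorder = record
    { isEquivalence = ≐ᴮ-isEquivalence
    ; reflexive     = λ {B C} → ⊑-reflexive ≤-refl {B} {C}
    ; trans         = λ {B C D} → ⊑-trans ≤-trans {B} {C} {D}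
    }
  ; antisym = λ {B C} → ⊑-antisym ≤-refl tol {B} {C}
  }
  where
  open IsPartialOrder po using () renaming (refl to ≤-refl; trans to ≤-trans)
  open Blocks _≤_ T
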